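{- Let $x=[a_1,a_2,a_3,\ldots]\in(0,1)$ (infinite regular continued fraction expansion), let $\tau_0:=0$ and $\tau_k:=\sum_{i=1}^k a_i$ for $k\in\mathbb{N}$, and let $\rho:=1-\gamma^{ -6}$ with $\gamma:=(1+\sqrt5)/2$. Then for every $k\in\mathbb{N}_0$, \[ q_k(x)\le\gamma^{\tau_k}\rho^{\tau_k-k-1}. \]
   Context: $q_k(x)$ denotes the denominator of the $k$-th approximant $p_k(x)/q_k(x)=[a_1,\ldots,a_k]$ in lowest terms, with $q_0(x):=1$. -}

module Defs where

open import Data.Nat as ℕ using (ℕ; zero; suc)
open import Data.Integer as ℤ using (ℤ; +_; -[1+_])
open import Data.Rational as ℚ using (ℚ; ↧ₙ_; 0ℚ; 1ℚ; ½)
open import Data.List using (List; []; _∷_; map; applyUpTo)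
open import Data.Nat.ListAction using (sum)
open import Data.Product using (_×_; _,_)
open import Data.Sum using (_⊎_)
open import Relation.Binary.PropositionalEquality using (_≡_; refl)

-- Finite continued fraction [b₁, …, bₘ] = 1/(b₁ + 1/(b₂ + … 1/bₘ)),
-- computed as an (unreduced) pair (numerator , denominator); [] = 0/1.
cfPair : List ℕ → ℕ × ℕ
cfPair []       = 0 , 1
cfPair (b ∷ bs) with cfPair bs
... | n , d = d , b ℕ.* d ℕ.+ n

-- The value as a rational number (reduced to lowest terms by ℚ._/_).
-- (The zero-denominator case never occurs for positive partial quotients.)
cfValue : List ℕ → ℚ
cfValue bs with cfPair bs
... | n , zero  = 0ℚ
... | n , suc d = + n ℚ./ suc d

-- The sequence of partial quotients is a : ℕ → ℕ, indexed from 1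
-- (a 0 is unused).  prefix a k = [a 1, …, a k].
prefix : (ℕ → ℕ) → ℕ → List ℕ
prefix a k = applyUpTo (λ i → a (suc i)) k

q : (ℕ → ℕ) → ℕ → ℕ
q a k = ↧ₙ (cfValue (prefix a k))

τ : (ℕ → ℕ) → ℕ → ℕ
τ a k = sum (prefix a k)

-- The real quadratic field ℚ(√5) ⊂ ℝ, with the order inherited from ℝ.

record ℚ√5 : Set where
  constructor _+_√5
  field
    re : ℚ
    im : ℚ
open ℚ√5 public

infixl 6 _⊕_ _⊖_
infixl 7 _⊗_

_⊕_ : ℚ√5 → ℚ√5 → ℚ√5
(a + b √5) ⊕ (c + d √5) = (a ℚ.+ c) + (b ℚ.+ d) √5

_⊖_ : ℚ√5 → ℚ√5 → ℚ√5
(a + b √5) ⊖ (c + d √5) = (a ℚ.- c) + (b ℚ.- d) √5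

_⊗_ : ℚ√5 → ℚ√5 → ℚ√5
(a + b √5) ⊗ (c + d √5) =
  (a ℚ.* c ℚ.+ (+ 5 ℚ./ 1) ℚ.* (b ℚ.* d)) + (a ℚ.* d ℚ.+ b ℚ.* c) √5

one : ℚ√5
one = 1ℚ + 0ℚ √5

fromℕ : ℕ → ℚ√5
fromℕ n = (+ n ℚ./ 1) + 0ℚ √5

_^_ : ℚ√5 → ℕ → ℚ√5
x ^ zero  = one
x ^ suc n = x ⊗ (x ^ n)

-- a + b√5 ≥ 0 as a real number
NonNeg : ℚ√5 → Set
NonNeg (a + b √5) =
    (0ℚ ℚ.≤ a × 0ℚ ℚ.≤ b)
  ⊎ ((0ℚ ℚ.≤ a × b ℚ.< 0ℚ) × (+ 5 ℚ./ 1) ℚ.* (b ℚ.* b) ℚ.≤ a ℚ.* a)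
  ⊎ ((a ℚ.< 0ℚ × 0ℚ ℚ.< b) × a ℚ.* a ℚ.≤ (+ 5 ℚ./ 1) ℚ.* (b ℚ.* b))

infix 4 _≤√_
_≤√_ : ℚ√5 → ℚ√5 → Set
x ≤√ y = NonNeg (y ⊖ x)

powℤ : (x x⁻¹ : ℚ√5) → ℤ → ℚ√5
powℤ x x⁻¹ (+ n)    = x ^ n
powℤ x x⁻¹ -[1+ n ] = x⁻¹ ^ suc n

γ : ℚ√5
γ = ½ + ½ √5

γ⁻¹ : ℚ√5
γ⁻¹ = (ℚ.- ½) + ½ √5

γ-inv : γ ⊗ γ⁻¹ ≡ one
γ-inv = refl

-- ρ = 1 − γ⁻⁶   (= 4√5 − 8),  ρ⁻¹ = (2 + √5)/4
ρ : ℚ√5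
ρ = one ⊖ (γ⁻¹ ^ 6)

ρ⁻¹ : ℚ√5
ρ⁻¹ = (+ 1 ℚ./ 2) + (+ 1 ℚ./ 4) √5

ρ-inv : ρ ⊗ ρ⁻¹ ≡ one
ρ-inv = refl

expo : (ℕ → ℕ) → ℕ → ℤ
expo a k = (+ τ a k) ℤ.- (+ k) ℤ.- + 1

-- Prepending a partial quotient b to [b₁, …, bₖ] maps the unreduced pair
-- (N, D) = cfPair [b₁, …, bₖ] to (D, bD + N), while the bound T = γ^τ ρ^(τ-k-1)
-- gets multiplied by Λ b = γ^b ρ^(b-1).  Along this recursion the two linear
-- bounds D + γ⁻¹N ≤ T and γ²D + N ≤ γ²ρ T propagate, using 0 ≤ N ≤ D: for b = 1
-- both follow from the first, for b = 2 from the second (as γ² = 2 + γ⁻¹), and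
-- for b ≥ 3 each from itself, because Λ b ≥ b + γ⁻¹.  Then q_k ≤ D ≤ T.
-- The inequalities are decided in the ordered field ℚ(√5).
module Submission where

open import Defs

open import Level using (0ℓ)
open import Data.Product using (_×_; _,_)
open import Data.Sum using (_⊎_; inj₁; inj₂)
open import Data.List using (List; []; _∷_; length)
open import Relation.Nullary using (¬_; yes; no; contradiction)
open import Relation.Nullary.Decidable using (Dec; map′; dec⇒maybe; from-yes; _×-dec_; _⊎-dec_)
open import Relation.Binary.PropositionalEquality
open import Relation.Binary.Definitions using (DecidableEquality)
import Tactic.RingSolver.Core.AlmostCommutativeRing as ACR
open import Tactic.RingSolver using (solve)

module Rational where

  open import Data.Integer as ℤ using (+_)
  import Data.Integer.Properties as ℤ
  open import Data.Nat as ℕ using (ℕ; zero; suc; z≤n; s≤s)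
  import Data.Nat.Properties as ℕ
  open import Data.Nat.Divisibility using (_∣_; divides; ∣-refl)
  import Data.Nat.Coprimality as Coprime
  open import Data.Rational
    using (ℚ; mkℚ; 0ℚ; 1ℚ; _+_; _*_; _-_; -_; _≤_; _<_; _/_; 1/_; ≢-nonZero; toℚᵘ; nonNegative; positive)
  import Data.Rational.Properties as ℚ
  import Data.Rational.Unnormalised as ℚᵘ
  import Data.Rational.Unnormalised.Properties as ℚᵘ

  ℚ-ring : ACR.AlmostCommutativeRing 0ℓ 0ℓ
  ℚ-ring = ACR.fromCommutativeRing ℚ.+-*-commutativeRing (λ x → dec⇒maybe (0ℚ ℚ.≟ x))

  five : ℚ
  five = + 5 / 1

  variable x y u v : ℚ

  0≤-+ : 0ℚ ≤ x → 0ℚ ≤ y → 0ℚ ≤ x + y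
  0≤-+ 0≤x 0≤y = ℚ.≤-trans (ℚ.≤-reflexive (sym (ℚ.+-identityˡ 0ℚ))) (ℚ.+-mono-≤ 0≤x 0≤y)

  0<-+ : 0ℚ < x → 0ℚ ≤ y → 0ℚ < x + y
  0<-+ 0<x 0≤y = ℚ.≤-<-trans (ℚ.≤-reflexive (sym (ℚ.+-identityˡ 0ℚ))) (ℚ.+-mono-<-≤ 0<x 0≤y)

  0≤-* : 0ℚ ≤ x → 0ℚ ≤ y → 0ℚ ≤ x * y
  0≤-* {x} {y} 0≤x 0≤y = ℚ.nonNegative⁻¹ (x * y)
    {{ℚ.nonNeg*nonNeg⇒nonNeg x {{nonNegative 0≤x}} y {{nonNegative 0≤y}}}}

  0<-* : 0ℚ < x → 0ℚ < y → 0ℚ < x * y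
  0<-* {x} {y} 0<x 0<y = ℚ.positive⁻¹ (x * y)
    {{ℚ.pos*pos⇒pos x {{positive 0<x}} y {{positive 0<y}}}}

  0≰⇒0<- : ¬ 0ℚ ≤ x → 0ℚ < - x
  0≰⇒0<- 0≰x = ℚ.neg-antimono-< (ℚ.≰⇒> 0≰x)

  0≰⇒0≤- : ¬ 0ℚ ≤ x → 0ℚ ≤ - x
  0≰⇒0≤- 0≰x = ℚ.<⇒≤ (0≰⇒0<- 0≰x)

  0<⇒0≰- : 0ℚ < x → ¬ 0ℚ ≤ - x
  0<⇒0≰- {x} 0<x 0≤-x = ℚ.<-irrefl (sym (ℚ.+-inverseʳ x)) (0<-+ 0<x 0≤-x)

  0≤x∧x*y≡1⇒0≤y : 0ℚ ≤ x → x * y ≡ 1ℚ → 0ℚ ≤ y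
  0≤x∧x*y≡1⇒0≤y {x} {y} 0≤x xy≡1 with 0ℚ ℚ.≤? y
  ... | yes 0≤y = 0≤y
  ... | no 0≰y = contradiction 0≤-1 (0<⇒0≰- (ℚ.positive⁻¹ 1ℚ))
    where
    0≤-1 : 0ℚ ≤ - 1ℚ
    0≤-1 = subst (0ℚ ≤_) (trans (sym (ℚ.neg-distribʳ-* x y)) (cong -_ xy≡1)) (0≤-* 0≤x (0≰⇒0≤- 0≰y))

  0≤y-x⇒x≤y : 0ℚ ≤ y - x → x ≤ y
  0≤y-x⇒x≤y {y} {x} 0≤y-x = begin
    x            ≡⟨ ℚ.+-identityˡ x ⟨
    0ℚ + x       ≤⟨ ℚ.+-monoˡ-≤ x 0≤y-x ⟩
    (y - x) + x  ≡⟨ solve (x ∷ y ∷ []) ℚ-ring ⟩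
    y            ∎
    where open ℚ.≤-Reasoning

  neg-involutive : ∀ x → - - x ≡ x
  neg-involutive x = solve (x ∷ []) ℚ-ring

  -x*-y≡x*y : ∀ x y → - x * - y ≡ x * y
  -x*-y≡x*y x y = solve (x ∷ y ∷ []) ℚ-ring

  0≤-square : ∀ x → 0ℚ ≤ x * x
  0≤-square x with ℚ.≤-total 0ℚ x
  ... | inj₁ 0≤x = 0≤-* 0≤x 0≤x
  ... | inj₂ x≤0 = subst (0ℚ ≤_) (-x*-y≡x*y x x) (0≤-* 0≤-x 0≤-x)
    where
    0≤-x : 0ℚ ≤ - x
    0≤-x = ℚ.neg-antimono-≤ x≤0

  -- Otherwise -(u + v) and u - v would be positive with product v² - u².
  0≤u∧v²≤u²⇒0≤u+v : 0ℚ ≤ u → 0ℚ ≤ u * u - v * v → 0ℚ ≤ u + v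
  0≤u∧v²≤u²⇒0≤u+v {u} {v} 0≤u 0≤u²-v² with 0ℚ ℚ.≤? u + v
  ... | yes 0≤u+v = 0≤u+v
  ... | no 0≰u+v = contradiction (subst (0ℚ ≤_) factor 0≤u²-v²) (0<⇒0≰- (0<-* 0<-[u+v] 0<u-v))
    where
    0<-[u+v] : 0ℚ < - (u + v)
    0<-[u+v] = 0≰⇒0<- 0≰u+v
    0<u-v : 0ℚ < u - v
    0<u-v = begin-strict
      0ℚ                    <⟨ 0<-+ 0<-[u+v] (0≤-+ 0≤u 0≤u) ⟩
      - (u + v) + (u + u)   ≡⟨ solve (u ∷ v ∷ []) ℚ-ring ⟩
      u - v                 ∎
      where open ℚ.≤-Reasoning
    factor : u * u - v * v ≡ - (- (u + v) * (u - v))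
    factor = solve (u ∷ v ∷ []) ℚ-ring

  ι : ℕ → ℚ
  ι n = + n / 1

  ι≡mkℚ : ∀ n → ι n ≡ mkℚ (+ n) 0 (Coprime.sym (Coprime.1-coprimeTo n))
  ι≡mkℚ n = ℚ.normalize-coprime (Coprime.sym (Coprime.1-coprimeTo n))

  ι-homo-+ : ∀ m n → ι (m ℕ.+ n) ≡ ι m + ι n
  ι-homo-+ m n rewrite ι≡mkℚ m | ι≡mkℚ n =
    cong (_/ 1) (sym (cong₂ ℤ._+_ (ℤ.*-identityʳ (+ m)) (ℤ.*-identityʳ (+ n))))

  ι-homo-* : ∀ m n → ι (m ℕ.* n) ≡ ι m * ι n
  ι-homo-* zero    n = sym (ℚ.*-zeroˡ (ι n))
  ι-homo-* (suc m) n = begin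
    ι (n ℕ.+ m ℕ.* n)     ≡⟨ ι-homo-+ n (m ℕ.* n) ⟩
    ι n + ι (m ℕ.* n)     ≡⟨ cong (λ t → ι n + t) (ι-homo-* m n) ⟩
    ι n + ι m * ι n       ≡⟨ y+x*y≡[1+x]*y (ι m) (ι n) ⟩
    (1ℚ + ι m) * ι n      ≡⟨ cong (_* ι n) (ι-homo-+ 1 m) ⟨
    ι (suc m) * ι n       ∎
    where
    open ≡-Reasoning
    y+x*y≡[1+x]*y : ∀ x y → y + x * y ≡ (1ℚ + x) * y
    y+x*y≡[1+x]*y x y = solve (x ∷ y ∷ []) ℚ-ring

  n*n≢5 : ∀ n → n ℕ.* n ≢ 5
  n*n≢5 0 ()
  n*n≢5 1 ()
  n*n≢5 2 ()
  -- 9 ≤ n * n = 5 is refuted by computation: T (9 ≤ᵇ 5) reduces to ⊥.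
  n*n≢5 n@(suc (suc (suc _))) n²≡5 = ℕ.≤⇒≤ᵇ (subst (9 ℕ.≤_) n²≡5 (ℕ.*-mono-≤ 3≤n 3≤n))
    where
    3≤n : 3 ℕ.≤ n
    3≤n = s≤s (s≤s (s≤s z≤n))

  -- A rational square root ∣n∣/D of 5 in lowest terms would give ∣n∣² = 5D², so D ∣ ∣n∣, so D = 1.
  x*x≢5 : ∀ x → x * x ≢ five
  x*x≢5 x@(mkℚ n d-1 coprime) x²≡5 =
    n*n≢5 ∣n∣ (subst (λ D → ∣n∣ ℕ.* ∣n∣ ≡ 5 ℕ.* (D ℕ.* D)) D≡1 ∣n∣²≡5D²)
    where
    ∣n∣ : ℕ
    ∣n∣ = ℤ.∣ n ∣
    D : ℕ
    D = suc d-1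
    unnormalised : toℚᵘ x ℚᵘ.* toℚᵘ x ℚᵘ.≃ toℚᵘ five
    unnormalised = ℚᵘ.≃-trans (ℚᵘ.≃-sym (ℚ.toℚᵘ-homo-* x x)) (ℚ.toℚᵘ-cong x²≡5)
    ∣n∣²≡5D² : ∣n∣ ℕ.* ∣n∣ ≡ 5 ℕ.* (D ℕ.* D)
    ∣n∣²≡5D² with unnormalised
    ... | ℚᵘ.*≡* n²≡5D² = begin
      ∣n∣ ℕ.* ∣n∣                 ≡⟨ ℤ.abs-* n n ⟨
      ℤ.∣ n ℤ.* n ∣               ≡⟨ cong ℤ.∣_∣ (ℤ.*-identityʳ (n ℤ.* n)) ⟨
      ℤ.∣ n ℤ.* n ℤ.* + 1 ∣       ≡⟨ cong ℤ.∣_∣ n²≡5D² ⟩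
      ℤ.∣ + 5 ℤ.* + (D ℕ.* D) ∣   ≡⟨ ℤ.abs-* (+ 5) (+ (D ℕ.* D)) ⟩
      5 ℕ.* (D ℕ.* D)             ∎
      where open ≡-Reasoning
    D∣∣n∣ : D ∣ ∣n∣
    D∣∣n∣ = Coprime.coprime-divisor (Coprime.sym (Coprime.recompute coprime))
              (divides (5 ℕ.* D) (trans ∣n∣²≡5D² (sym (ℕ.*-assoc 5 D D))))
    D≡1 : D ≡ 1
    D≡1 = Coprime.recompute coprime (D∣∣n∣ , ∣-refl)

  x*x≡0⇒x≡0 : x * x ≡ 0ℚ → x ≡ 0ℚ
  x*x≡0⇒x≡0 {x} x²≡0 with x ℚ.≟ 0ℚ
  ... | yes x≡0 = x≡0
  ... | no x≢0 = cancel (1/ x) (ℚ.*-inverseʳ x)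
    where
    instance _ = ≢-nonZero x≢0
    cancel : ∀ i → x * i ≡ 1ℚ → x ≡ 0ℚ
    cancel i xi≡1 = begin
      x              ≡⟨ ℚ.*-identityʳ x ⟨
      x * 1ℚ         ≡⟨ cong (x *_) xi≡1 ⟨
      x * (x * i)    ≡⟨ solve (x ∷ i ∷ []) ℚ-ring ⟩
      (x * x) * i    ≡⟨ cong (_* i) x²≡0 ⟩
      0ℚ * i         ≡⟨ ℚ.*-zeroˡ i ⟩
      0ℚ             ∎
      where open ≡-Reasoning

  x*x≡5y*y⇒y≡0 : x * x ≡ five * (y * y) → y ≡ 0ℚ
  x*x≡5y*y⇒y≡0 {x} {y} x²≡5y² with y ℚ.≟ 0ℚ
  ... | yes y≡0 = y≡0
  ... | no y≢0 = contradiction (square≡5 (1/ y) (ℚ.*-inverseʳ y)) (x*x≢5 (x * 1/ y))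
    where
    instance _ = ≢-nonZero y≢0
    square≡5 : ∀ i → y * i ≡ 1ℚ → (x * i) * (x * i) ≡ five
    square≡5 i yi≡1 = begin
      (x * i) * (x * i)           ≡⟨ solve (x ∷ i ∷ []) ℚ-ring ⟩
      (x * x) * (i * i)           ≡⟨ cong (_* (i * i)) x²≡5y² ⟩
      five * (y * y) * (i * i)    ≡⟨ solve (y ∷ i ∷ []) ℚ-ring ⟩
      five * ((y * i) * (y * i))  ≡⟨ cong (λ t → five * (t * t)) yi≡1 ⟩
      five                        ∎
      where open ≡-Reasoning

module QuadraticField where

  open Rational
  open import Data.Rational using (ℚ; 0ℚ; 1ℚ; _+_; _*_; _-_; -_; _≤_; _<_; 1/_; ≢-nonZero)
  import Data.Rational.Properties as ℚ
  open import Algebra.Bundles using (CommutativeRing)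
  open import Algebra.Structures {A = ℚ√5} _≡_ using (IsCommutativeRing)
  open import Relation.Binary.Structures using (IsPreorder)
  open import Relation.Binary.Bundles using (Preorder)
  import Relation.Binary.Reasoning.Preorder
  open import Data.Nat as ℕ using (ℕ; zero; suc)
  import Data.Nat.Properties as ℕ
  open import Data.Integer as ℤ using (+_)

  negate : ℚ√5 → ℚ√5
  negate (a + b √5) = (- a) + (- b) √5

  zero√5 : ℚ√5
  zero√5 = 0ℚ + 0ℚ √5

  ⊕-assoc : ∀ x y z → (x ⊕ y) ⊕ z ≡ x ⊕ (y ⊕ z)
  ⊕-assoc (a + b √5) (c + d √5) (e + f √5) = cong₂ _+_√5 (ℚ.+-assoc a c e) (ℚ.+-assoc b d f)

  ⊕-comm : ∀ x y → x ⊕ y ≡ y ⊕ x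
  ⊕-comm (a + b √5) (c + d √5) = cong₂ _+_√5 (ℚ.+-comm a c) (ℚ.+-comm b d)

  ⊕-identityˡ : ∀ x → zero√5 ⊕ x ≡ x
  ⊕-identityˡ (a + b √5) = cong₂ _+_√5 (ℚ.+-identityˡ a) (ℚ.+-identityˡ b)

  ⊕-identityʳ : ∀ x → x ⊕ zero√5 ≡ x
  ⊕-identityʳ (a + b √5) = cong₂ _+_√5 (ℚ.+-identityʳ a) (ℚ.+-identityʳ b)

  ⊕-inverseˡ : ∀ x → negate x ⊕ x ≡ zero√5
  ⊕-inverseˡ (a + b √5) = cong₂ _+_√5 (ℚ.+-inverseˡ a) (ℚ.+-inverseˡ b)

  ⊕-inverseʳ : ∀ x → x ⊕ negate x ≡ zero√5
  ⊕-inverseʳ (a + b √5) = cong₂ _+_√5 (ℚ.+-inverseʳ a) (ℚ.+-inverseʳ b)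

  ⊗-assoc : ∀ x y z → (x ⊗ y) ⊗ z ≡ x ⊗ (y ⊗ z)
  ⊗-assoc (a + b √5) (c + d √5) (e + f √5) = cong₂ _+_√5 rational irrational
    where
    rational : (a * c + five * (b * d)) * e + five * ((a * d + b * c) * f)
             ≡ a * (c * e + five * (d * f)) + five * (b * (c * f + d * e))
    rational = solve (a ∷ b ∷ c ∷ d ∷ e ∷ f ∷ []) ℚ-ring
    irrational : (a * c + five * (b * d)) * f + (a * d + b * c) * e
               ≡ a * (c * f + d * e) + b * (c * e + five * (d * f))
    irrational = solve (a ∷ b ∷ c ∷ d ∷ e ∷ f ∷ []) ℚ-ring

  ⊗-comm : ∀ x y → x ⊗ y ≡ y ⊗ x
  ⊗-comm (a + b √5) (c + d √5) = cong₂ _+_√5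
    (cong₂ _+_ (ℚ.*-comm a c) (cong (five *_) (ℚ.*-comm b d)))
    (trans (ℚ.+-comm (a * d) (b * c)) (cong₂ _+_ (ℚ.*-comm b c) (ℚ.*-comm a d)))

  ⊗-identityˡ : ∀ x → one ⊗ x ≡ x
  ⊗-identityˡ (a + b √5) = cong₂ _+_√5 rational irrational
    where
    rational : 1ℚ * a + five * (0ℚ * b) ≡ a
    rational = solve (a ∷ b ∷ []) ℚ-ring
    irrational : 1ℚ * b + 0ℚ * a ≡ b
    irrational = solve (a ∷ b ∷ []) ℚ-ring

  ⊗-identityʳ : ∀ x → x ⊗ one ≡ x
  ⊗-identityʳ x = trans (⊗-comm x one) (⊗-identityˡ x)

  ⊗-distribˡ-⊕ : ∀ x y z → x ⊗ (y ⊕ z) ≡ x ⊗ y ⊕ x ⊗ z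
  ⊗-distribˡ-⊕ (a + b √5) (c + d √5) (e + f √5) = cong₂ _+_√5 rational irrational
    where
    rational : a * (c + e) + five * (b * (d + f)) ≡ (a * c + five * (b * d)) + (a * e + five * (b * f))
    rational = solve (a ∷ b ∷ c ∷ d ∷ e ∷ f ∷ []) ℚ-ring
    irrational : a * (d + f) + b * (c + e) ≡ (a * d + b * c) + (a * f + b * e)
    irrational = solve (a ∷ b ∷ c ∷ d ∷ e ∷ f ∷ []) ℚ-ring

  ⊗-distribʳ-⊕ : ∀ x y z → (y ⊕ z) ⊗ x ≡ y ⊗ x ⊕ z ⊗ x
  ⊗-distribʳ-⊕ x y z = begin
    (y ⊕ z) ⊗ x      ≡⟨ ⊗-comm (y ⊕ z) x ⟩
    x ⊗ (y ⊕ z)      ≡⟨ ⊗-distribˡ-⊕ x y z ⟩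
    x ⊗ y ⊕ x ⊗ z    ≡⟨ cong₂ _⊕_ (⊗-comm x y) (⊗-comm x z) ⟩
    y ⊗ x ⊕ z ⊗ x    ∎
    where open ≡-Reasoning

  +-*-isCommutativeRing : IsCommutativeRing _⊕_ _⊗_ negate zero√5 one
  +-*-isCommutativeRing = record
    { isRing = record
      { +-isAbelianGroup = record
        { isGroup = record
          { isMonoid = record
            { isSemigroup = record
              { isMagma = record { isEquivalence = isEquivalence ; ∙-cong = cong₂ _⊕_ }
              ; assoc = ⊕-assoc }
            ; identity = ⊕-identityˡ , ⊕-identityʳ }
          ; inverse = ⊕-inverseˡ , ⊕-inverseʳ
          ; ⁻¹-cong = cong negate }
        ; comm = ⊕-comm }
      ; *-cong = cong₂ _⊗_
      ; *-assoc = ⊗-assoc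
      ; *-identity = ⊗-identityˡ , ⊗-identityʳ
      ; distrib = ⊗-distribˡ-⊕ , ⊗-distribʳ-⊕ }
    ; *-comm = ⊗-comm }

  +-*-commutativeRing : CommutativeRing 0ℓ 0ℓ
  +-*-commutativeRing = record { isCommutativeRing = +-*-isCommutativeRing }

  _≟_ : DecidableEquality ℚ√5
  (a + b √5) ≟ (c + d √5) with a ℚ.≟ c | b ℚ.≟ d
  ... | yes refl | yes refl = yes refl
  ... | no a≢c   | _        = no λ { refl → a≢c refl }
  ... | _        | no b≢d   = no λ { refl → b≢d refl }

  open import Algebra.Properties.CommutativeSemigroup (CommutativeRing.*-commutativeSemigroup +-*-commutativeRing)
    public using (interchange; x∙yz≈y∙xz)

  ℚ√5-ring : ACR.AlmostCommutativeRing 0ℓ 0ℓ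
  ℚ√5-ring = ACR.fromCommutativeRing +-*-commutativeRing (λ x → dec⇒maybe (zero√5 ≟ x))

  norm : ℚ√5 → ℚ
  norm (a + b √5) = a * a - five * (b * b)

  norm-⊗ : ∀ x y → norm (x ⊗ y) ≡ norm x * norm y
  norm-⊗ (a + b √5) (c + d √5) = brahmagupta
    where
    brahmagupta : (a * c + five * (b * d)) * (a * c + five * (b * d)) - five * ((a * d + b * c) * (a * d + b * c))
                ≡ (a * a - five * (b * b)) * (c * c - five * (d * d))
    brahmagupta = solve (a ∷ b ∷ c ∷ d ∷ []) ℚ-ring

  -- The real number a + b√5 is ≥ 0 iff a ≥ 0 and a² ≥ 5b², or b ≥ 0 and 5b² ≥ a²;
  -- unlike NonNeg this uses no strict inequalities, so it needs fewer case splits.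
  0≤_ : ℚ√5 → Set
  0≤ x@(a + b √5) = (0ℚ ≤ a × 0ℚ ≤ norm x) ⊎ (0ℚ ≤ b × 0ℚ ≤ - norm x)

  0≤five : 0ℚ ≤ five
  0≤five = ℚ.nonNegative⁻¹ five

  0≤-⊗ : ∀ x y → 0≤ x → 0≤ y → 0≤ (x ⊗ y)
  0≤-⊗ (a + b √5) (c + d √5) (inj₁ (0≤a , 0≤N)) (inj₁ (0≤c , 0≤M)) =
    inj₁ (0≤re , subst (0ℚ ≤_) (sym (norm-⊗ (a + b √5) (c + d √5))) (0≤-* 0≤N 0≤M))
    where
    0≤re : 0ℚ ≤ a * c + five * (b * d)
    0≤re = 0≤u∧v²≤u²⇒0≤u+v (0≤-* 0≤a 0≤c) (begin
      0ℚ
        ≤⟨ 0≤-+ (0≤-* 0≤N (0≤-square c)) (0≤-* (0≤-* 0≤five (0≤-square b)) 0≤M) ⟩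
      (a * a - five * (b * b)) * (c * c) + five * (b * b) * (c * c - five * (d * d))
        ≡⟨ solve (a ∷ b ∷ c ∷ d ∷ []) ℚ-ring ⟩
      (a * c) * (a * c) - (five * (b * d)) * (five * (b * d)) ∎)
      where open ℚ.≤-Reasoning
  0≤-⊗ (a + b √5) (c + d √5) (inj₁ (0≤a , 0≤N)) (inj₂ (0≤d , 0≤-M)) =
    inj₂ (0≤im , subst (0ℚ ≤_) -N*M≡-norm (0≤-* 0≤N 0≤-M))
    where
    N : ℚ
    N = norm (a + b √5)
    M : ℚ
    M = norm (c + d √5)
    -N*M≡-norm : N * - M ≡ - norm ((a + b √5) ⊗ (c + d √5))
    -N*M≡-norm = trans (sym (ℚ.neg-distribʳ-* N M)) (cong -_ (sym (norm-⊗ (a + b √5) (c + d √5))))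
    0≤im : 0ℚ ≤ a * d + b * c
    0≤im = 0≤u∧v²≤u²⇒0≤u+v (0≤-* 0≤a 0≤d) (begin
      0ℚ
        ≤⟨ 0≤-+ (0≤-* 0≤N (0≤-square d)) (0≤-* (0≤-square b) 0≤-M) ⟩
      (a * a - five * (b * b)) * (d * d) + (b * b) * - (c * c - five * (d * d))
        ≡⟨ solve (a ∷ b ∷ c ∷ d ∷ []) ℚ-ring ⟩
      (a * d) * (a * d) - (b * c) * (b * c) ∎)
      where open ℚ.≤-Reasoning
  0≤-⊗ x@(_ + _ √5) y@(_ + _ √5) 0≤x@(inj₂ _) 0≤y@(inj₁ _) =
    subst 0≤_ (⊗-comm y x) (0≤-⊗ y x 0≤y 0≤x)
  0≤-⊗ (a + b √5) (c + d √5) (inj₂ (0≤b , 0≤-N)) (inj₂ (0≤d , 0≤-M)) =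
    inj₁ (0≤re , subst (0ℚ ≤_) -N*-M≡norm (0≤-* 0≤-N 0≤-M))
    where
    N : ℚ
    N = norm (a + b √5)
    M : ℚ
    M = norm (c + d √5)
    -N*-M≡norm : - N * - M ≡ norm ((a + b √5) ⊗ (c + d √5))
    -N*-M≡norm = trans (-x*-y≡x*y N M) (sym (norm-⊗ (a + b √5) (c + d √5)))
    0≤re : 0ℚ ≤ a * c + five * (b * d)
    0≤re = subst (0ℚ ≤_) (ℚ.+-comm (five * (b * d)) (a * c))
      (0≤u∧v²≤u²⇒0≤u+v (0≤-* 0≤five (0≤-* 0≤b 0≤d)) (begin
        0ℚ
          ≤⟨ 0≤-+ (0≤-* (0≤-* 0≤five (0≤-square b)) 0≤-M) (0≤-* (0≤-square c) 0≤-N) ⟩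
        five * (b * b) * - (c * c - five * (d * d)) + (c * c) * - (a * a - five * (b * b))
          ≡⟨ solve (a ∷ b ∷ c ∷ d ∷ []) ℚ-ring ⟩
        (five * (b * d)) * (five * (b * d)) - (a * c) * (a * c) ∎))
      where open ℚ.≤-Reasoning

  0≤-1⊕ : ∀ x → 0≤ x → 0≤ (one ⊕ x)
  0≤-1⊕ (c + d √5) (inj₁ (0≤c , 0≤M)) = inj₁ (0≤1+c , 0≤norm)
    where
    0≤1+c : 0ℚ ≤ 1ℚ + c
    0≤1+c = 0≤-+ (ℚ.nonNegative⁻¹ 1ℚ) 0≤c
    0≤norm : 0ℚ ≤ (1ℚ + c) * (1ℚ + c) - five * ((0ℚ + d) * (0ℚ + d))
    0≤norm = begin
      0ℚ                                                   ≤⟨ 0≤-+ 0≤M (0≤-+ 0≤1+c 0≤c) ⟩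
      (c * c - five * (d * d)) + ((1ℚ + c) + c)            ≡⟨ solve (c ∷ d ∷ []) ℚ-ring ⟩
      (1ℚ + c) * (1ℚ + c) - five * ((0ℚ + d) * (0ℚ + d))   ∎
      where open ℚ.≤-Reasoning
  0≤-1⊕ (c + d √5) (inj₂ (0≤d , 0≤-M)) with 0ℚ ℚ.≤? - norm (one ⊕ (c + d √5))
  ... | yes 0≤-norm = inj₂ (subst (0ℚ ≤_) (sym (ℚ.+-identityˡ d)) 0≤d , 0≤-norm)
  ... | no 0≰-norm = inj₁ (0≤1+c , 0≤norm)
    where
    0≤norm : 0ℚ ≤ norm (one ⊕ (c + d √5))
    0≤norm = subst (0ℚ ≤_) (neg-involutive _) (0≰⇒0≤- 0≰-norm)
    -- if 1 + c < 0, then -norm (1 + x) = -norm x - 2(1 + c) + 1 would be ≥ 0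
    0≤1+c : 0ℚ ≤ 1ℚ + c
    0≤1+c with 0ℚ ℚ.≤? 1ℚ + c
    ... | yes 0≤1+c = 0≤1+c
    ... | no 0≰1+c = contradiction (begin
      0ℚ
        ≤⟨ 0≤-+ 0≤-M (0≤-+ (0≤-+ 0≤-[1+c] 0≤-[1+c]) (ℚ.nonNegative⁻¹ 1ℚ)) ⟩
      - (c * c - five * (d * d)) + ((- (1ℚ + c) + - (1ℚ + c)) + 1ℚ)
        ≡⟨ solve (c ∷ d ∷ []) ℚ-ring ⟩
      - ((1ℚ + c) * (1ℚ + c) - five * ((0ℚ + d) * (0ℚ + d)))    ∎) 0≰-norm
      where
      open ℚ.≤-Reasoning
      0≤-[1+c] : 0ℚ ≤ - (1ℚ + c)
      0≤-[1+c] = 0≰⇒0≤- 0≰1+c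

  scaledConjugate : ℚ → ℚ√5 → ℚ√5
  scaledConjugate i (a + b √5) = (a * i) + (- (b * i)) √5

  ⊗-scaledConjugate : ∀ x i → norm x * i ≡ 1ℚ → x ⊗ scaledConjugate i x ≡ one
  ⊗-scaledConjugate (a + b √5) i Ni≡1 = cong₂ _+_√5 (trans rational Ni≡1) irrational
    where
    rational : a * (a * i) + five * (b * - (b * i)) ≡ (a * a - five * (b * b)) * i
    rational = solve (a ∷ b ∷ i ∷ []) ℚ-ring
    irrational : a * - (b * i) + b * (a * i) ≡ 0ℚ
    irrational = solve (a ∷ b ∷ i ∷ []) ℚ-ring

  norm-scaledConjugate : ∀ a b i → norm (scaledConjugate i (a + b √5)) ≡ norm (a + b √5) * (i * i)
  norm-scaledConjugate a b i = identity
    where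
    identity : (a * i) * (a * i) - five * (- (b * i) * - (b * i)) ≡ (a * a - five * (b * b)) * (i * i)
    identity = solve (a ∷ b ∷ i ∷ []) ℚ-ring

  0≤-scaledConjugate : ∀ x i → 0≤ x → norm x * i ≡ 1ℚ → 0≤ (scaledConjugate i x)
  0≤-scaledConjugate (a + b √5) i (inj₁ (0≤a , 0≤N)) Ni≡1 =
    inj₁ ( 0≤-* 0≤a (0≤x∧x*y≡1⇒0≤y 0≤N Ni≡1)
         , subst (0ℚ ≤_) (sym (norm-scaledConjugate a b i)) (0≤-* 0≤N (0≤-square i)))
  0≤-scaledConjugate (a + b √5) i (inj₂ (0≤b , 0≤-N)) Ni≡1 =
    inj₂ ( subst (0ℚ ≤_) (sym (ℚ.neg-distribʳ-* b i)) (0≤-* 0≤b 0≤-i)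
         , subst (0ℚ ≤_) -N*i²≡-norm (0≤-* 0≤-N (0≤-square i)))
    where
    0≤-i : 0ℚ ≤ - i
    0≤-i = 0≤x∧x*y≡1⇒0≤y 0≤-N (trans (-x*-y≡x*y (norm (a + b √5)) i) Ni≡1)
    -N*i²≡-norm : - norm (a + b √5) * (i * i) ≡ - norm (scaledConjugate i (a + b √5))
    -N*i²≡-norm = trans (sym (ℚ.neg-distribˡ-* (norm (a + b √5)) (i * i))) (cong -_ (sym (norm-scaledConjugate a b i)))

  norm≡0⇒≡0 : ∀ x → norm x ≡ 0ℚ → x ≡ zero√5
  norm≡0⇒≡0 (a + b √5) N≡0 = cong₂ _+_√5 a≡0 b≡0
    where
    a²≡5b² : a * a ≡ five * (b * b)
    a²≡5b² = begin
      a * a                                      ≡⟨ solve (a ∷ b ∷ []) ℚ-ring ⟩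
      (a * a - five * (b * b)) + five * (b * b)  ≡⟨ cong (_+ five * (b * b)) N≡0 ⟩
      0ℚ + five * (b * b)                        ≡⟨ ℚ.+-identityˡ (five * (b * b)) ⟩
      five * (b * b)                             ∎
      where open ≡-Reasoning
    b≡0 : b ≡ 0ℚ
    b≡0 = x*x≡5y*y⇒y≡0 {a} a²≡5b²
    a≡0 : a ≡ 0ℚ
    a≡0 = x*x≡0⇒x≡0 {a} (trans a²≡5b² (cong (λ t → five * (t * t)) b≡0))

  x⊗[1⊕x′⊗y]≡x⊕y : ∀ x x′ y → x ⊗ x′ ≡ one → x ⊗ (one ⊕ x′ ⊗ y) ≡ x ⊕ y
  x⊗[1⊕x′⊗y]≡x⊕y x x′ y xx′≡1 = begin
    x ⊗ (one ⊕ x′ ⊗ y)   ≡⟨ solve (x ∷ x′ ∷ y ∷ []) ℚ√5-ring ⟩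
    x ⊕ (x ⊗ x′) ⊗ y     ≡⟨ cong (λ t → x ⊕ t ⊗ y) xx′≡1 ⟩
    x ⊕ one ⊗ y          ≡⟨ cong (x ⊕_) (⊗-identityˡ y) ⟩
    x ⊕ y                ∎
    where open ≡-Reasoning

  -- x + y = x (1 + x⁻¹ y) when norm x ≠ 0; otherwise x = 0 since √5 is irrational.
  0≤-⊕ : ∀ x y → 0≤ x → 0≤ y → 0≤ (x ⊕ y)
  0≤-⊕ x y 0≤x 0≤y with norm x ℚ.≟ 0ℚ
  ... | yes N≡0 =
    subst (λ z → 0≤ (z ⊕ y)) (sym (norm≡0⇒≡0 x N≡0)) (subst 0≤_ (sym (⊕-identityˡ y)) 0≤y)
  ... | no N≢0 = subst 0≤_ (x⊗[1⊕x′⊗y]≡x⊕y x x⁻¹ y (⊗-scaledConjugate x i Ni≡1))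
                   (0≤-⊗ x _ 0≤x (0≤-1⊕ _ (0≤-⊗ x⁻¹ y (0≤-scaledConjugate x i 0≤x Ni≡1) 0≤y)))
    where
    instance _ = ≢-nonZero N≢0
    i : ℚ
    i = 1/ norm x
    Ni≡1 : norm x * i ≡ 1ℚ
    Ni≡1 = ℚ.*-inverseʳ (norm x)
    x⁻¹ : ℚ√5
    x⁻¹ = scaledConjugate i x

  0≤? : ∀ x → Dec (0≤ x)
  0≤? x@(a + b √5) =
    ((0ℚ ℚ.≤? a) ×-dec (0ℚ ℚ.≤? norm x)) ⊎-dec ((0ℚ ℚ.≤? b) ×-dec (0ℚ ℚ.≤? - norm x))

  0≤⇒NonNeg : ∀ x → 0≤ x → NonNeg x
  0≤⇒NonNeg (a + b √5) (inj₁ (0≤a , 0≤N)) with 0ℚ ℚ.≤? b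
  ... | yes 0≤b = inj₁ (0≤a , 0≤b)
  ... | no 0≰b = inj₂ (inj₁ ((0≤a , ℚ.≰⇒> 0≰b) , 0≤y-x⇒x≤y 0≤N))
  0≤⇒NonNeg (a + b √5) (inj₂ (0≤b , 0≤-N)) with 0ℚ ℚ.≤? a | 0ℚ ℚ.<? b
  ... | yes 0≤a | _      = inj₁ (0≤a , 0≤b)
  ... | no 0≰a  | yes 0<b =
    inj₂ (inj₂ ((ℚ.≰⇒> 0≰a , 0<b) , 0≤y-x⇒x≤y (subst (0ℚ ≤_) -N≡5b²-a² 0≤-N)))
    where
    -N≡5b²-a² : - (a * a - five * (b * b)) ≡ five * (b * b) - a * a
    -N≡5b²-a² = solve (a ∷ b ∷ []) ℚ-ring
  ... | no 0≰a  | no 0≮b = contradiction (subst (0ℚ ≤_) -N≡-a² 0≤-N) (0<⇒0≰- 0<a²)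
    where
    0<a² : 0ℚ < a * a
    0<a² = subst (0ℚ <_) (-x*-y≡x*y a a) (0<-* (0≰⇒0<- 0≰a) (0≰⇒0<- 0≰a))
    b≡0 : b ≡ 0ℚ
    b≡0 = ℚ.≤-antisym (ℚ.≮⇒≥ 0≮b) 0≤b
    -N≡-a² : - (a * a - five * (b * b)) ≡ - (a * a)
    -N≡-a² = begin
      - (a * a - five * (b * b))    ≡⟨ cong (λ t → - (a * a - five * (t * t))) b≡0 ⟩
      - (a * a - five * (0ℚ * 0ℚ))  ≡⟨ solve (a ∷ []) ℚ-ring ⟩
      - (a * a)                     ∎
      where open ≡-Reasoning

  -- Differences are written x ⊕ negate y, definitionally equal to x ⊖ y,
  -- because the ring solver does not recognise _⊖_.
  infix 4 _≼_
  record _≼_ (x y : ℚ√5) : Set where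
    constructor 0≤⊖
    field 0≤y-x : 0≤ (y ⊕ negate x)

  ≼-trans : ∀ {x y z} → x ≼ y → y ≼ z → x ≼ z
  ≼-trans {x} {y} {z} (0≤⊖ 0≤y-x) (0≤⊖ 0≤z-y) = 0≤⊖ (subst 0≤_ telescope (0≤-⊕ _ _ 0≤z-y 0≤y-x))
    where
    telescope : (z ⊕ negate y) ⊕ (y ⊕ negate x) ≡ z ⊕ negate x
    telescope = solve (x ∷ y ∷ z ∷ []) ℚ√5-ring

  ≼-reflexive : ∀ {x y} → x ≡ y → x ≼ y
  ≼-reflexive {x} refl = 0≤⊖ (subst 0≤_ (sym (⊕-inverseʳ x)) (from-yes (0≤? zero√5)))

  ≼-isPreorder : IsPreorder _≡_ _≼_
  ≼-isPreorder = record { isEquivalence = isEquivalence ; reflexive = ≼-reflexive ; trans = ≼-trans }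

  ≼-preorder : Preorder 0ℓ 0ℓ 0ℓ
  ≼-preorder = record { isPreorder = ≼-isPreorder }

  module ≼-Reasoning = Relation.Binary.Reasoning.Preorder ≼-preorder

  ≼-respʳ-≡ : ∀ {x y z} → y ≡ z → x ≼ y → x ≼ z
  ≼-respʳ-≡ refl x≼y = x≼y

  infix 4 _≼?_
  _≼?_ : ∀ x y → Dec (x ≼ y)
  x ≼? y = map′ 0≤⊖ _≼_.0≤y-x (0≤? (y ⊕ negate x))

  ≼⊕ : ∀ x {y} → 0≤ y → x ≼ x ⊕ y
  ≼⊕ x {y} 0≤y = 0≤⊖ (subst 0≤_ (sym cancel) 0≤y)
    where
    cancel : (x ⊕ y) ⊕ negate x ≡ y
    cancel = solve (x ∷ y ∷ []) ℚ√5-ring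

  ≼⇒≤√ : ∀ {x y} → x ≼ y → x ≤√ y
  ≼⇒≤√ {x} {y} (0≤⊖ 0≤y-x) = 0≤⇒NonNeg (y ⊖ x) 0≤y-x

  fromℕ-homo-+ : ∀ m n → fromℕ (m ℕ.+ n) ≡ fromℕ m ⊕ fromℕ n
  fromℕ-homo-+ m n = cong₂ _+_√5 (ι-homo-+ m n) refl

  fromℕ-homo-* : ∀ m n → fromℕ (m ℕ.* n) ≡ fromℕ m ⊗ fromℕ n
  fromℕ-homo-* m n = cong₂ _+_√5
    (trans (ι-homo-* m n) (sym (ℚ.+-identityʳ (ι m * ι n))))
    (sym (trans (cong₂ _+_ (ℚ.*-zeroʳ (ι m)) (ℚ.*-zeroˡ (ι n))) (ℚ.+-identityʳ 0ℚ)))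

  0≤-fromℕ : ∀ n → 0≤ fromℕ n
  0≤-fromℕ n = inj₁ (ℚ.nonNegative⁻¹ (ι n) {{ℚ.normalize-nonNeg n 1}} ,
                     subst (0ℚ ≤_) (sym (ℚ.+-identityʳ (ι n * ι n))) (0≤-square (ι n)))

  fromℕ-mono-≼ : ∀ {m n} → m ℕ.≤ n → fromℕ m ≼ fromℕ n
  fromℕ-mono-≼ {m} {n} m≤n = subst (fromℕ m ≼_) m+[n∸m]≡n (≼⊕ (fromℕ m) (0≤-fromℕ (n ℕ.∸ m)))
    where
    m+[n∸m]≡n : fromℕ m ⊕ fromℕ (n ℕ.∸ m) ≡ fromℕ n
    m+[n∸m]≡n = trans (sym (fromℕ-homo-+ m (n ℕ.∸ m))) (cong fromℕ (ℕ.m+[n∸m]≡n m≤n))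

  record Dominates (l x y u v : ℚ√5) : Set where
    constructor dominates
    field
      0≤l            : 0≤ l
      0≤lx-u         : 0≤ (l ⊗ x ⊕ negate u)
      0≤l[x+y]-[u+v] : 0≤ ((l ⊗ x ⊕ negate u) ⊕ (l ⊗ y ⊕ negate v))

  dominates? : ∀ l x y u v → Dec (Dominates l x y u v)
  dominates? l x y u v = map′ (λ (p , q , r) → dominates p q r) (λ (dominates p q r) → p , q , r)
    (0≤? l ×-dec 0≤? (l ⊗ x ⊕ negate u) ×-dec 0≤? ((l ⊗ x ⊕ negate u) ⊕ (l ⊗ y ⊕ negate v)))

  -- (l x - u) D + (l y - v) N = (l x - u) (D - N) + (l (x + y) - (u + v)) N
  ≼-rescale : ∀ {l x y u v D N S} → Dominates l x y u v → 0≤ N → N ≼ D →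
              x ⊗ D ⊕ y ⊗ N ≼ S → u ⊗ D ⊕ v ⊗ N ≼ l ⊗ S
  ≼-rescale {l} {x} {y} {u} {v} {D} {N} {S}
    (dominates 0≤l 0≤lx-u 0≤l[x+y]-[u+v]) 0≤N (0≤⊖ 0≤D-N) (0≤⊖ 0≤S-[xD+yN]) =
    0≤⊖ (subst 0≤_ (sym split)
      (0≤-⊕ _ _ (0≤-⊗ l _ 0≤l 0≤S-[xD+yN])
                (0≤-⊕ _ _ (0≤-⊗ _ _ 0≤lx-u 0≤D-N) (0≤-⊗ _ N 0≤l[x+y]-[u+v] 0≤N))))
    where
    split : l ⊗ S ⊕ negate (u ⊗ D ⊕ v ⊗ N)
          ≡ l ⊗ (S ⊕ negate (x ⊗ D ⊕ y ⊗ N))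
            ⊕ ((l ⊗ x ⊕ negate u) ⊗ (D ⊕ negate N) ⊕ ((l ⊗ x ⊕ negate u) ⊕ (l ⊗ y ⊕ negate v)) ⊗ N)
    split = solve (x ∷ y ∷ u ∷ v ∷ D ∷ N ∷ S ∷ l ∷ []) ℚ√5-ring

  ^-homo-+ : ∀ x m n → x ^ (m ℕ.+ n) ≡ x ^ m ⊗ x ^ n
  ^-homo-+ x zero    n = sym (⊗-identityˡ (x ^ n))
  ^-homo-+ x (suc m) n = trans (cong (x ⊗_) (^-homo-+ x m n)) (sym (⊗-assoc x (x ^ m) (x ^ n)))

  powℤ-pred : ∀ x x⁻¹ → x ⊗ x⁻¹ ≡ one → ∀ e → powℤ x x⁻¹ (+ e ℤ.- + 1) ≡ x ^ e ⊗ x⁻¹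
  powℤ-pred x x⁻¹ xx⁻¹≡1 zero    = ⊗-comm x⁻¹ one
  powℤ-pred x x⁻¹ xx⁻¹≡1 (suc e) = begin
    x ^ e                  ≡⟨ ⊗-identityʳ (x ^ e) ⟨
    x ^ e ⊗ one            ≡⟨ cong (x ^ e ⊗_) xx⁻¹≡1 ⟨
    x ^ e ⊗ (x ⊗ x⁻¹)      ≡⟨ rearrange (x ^ e) ⟩
    (x ⊗ x ^ e) ⊗ x⁻¹      ∎
    where
    open ≡-Reasoning
    rearrange : ∀ p → p ⊗ (x ⊗ x⁻¹) ≡ (x ⊗ p) ⊗ x⁻¹
    rearrange p = solve (p ∷ x ∷ x⁻¹ ∷ []) ℚ√5-ring

open QuadraticField
open import Data.Nat using (ℕ; zero; suc; _≤_; _+_; _*_; _∸_; z≤n; s≤s)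
import Data.Nat.Properties as ℕ
open import Data.Nat.Divisibility using (_∣_; m∣m*n; ∣⇒≤)
open import Data.Nat.GCD using (gcd)
open import Data.Nat.ListAction using (sum)
open import Data.Integer as ℤ using (+_)
import Data.Integer.Properties as ℤ
open import Data.Rational using (↧ₙ_; _/_)
import Data.Rational.Properties as ℚ
open import Data.Product using (proj₁; proj₂)

Λ : ℕ → ℚ√5
Λ m = γ ^ m ⊗ ρ ^ (m ∸ 1)

Λ-suc : ∀ m → Λ (suc (suc m)) ≡ (γ ⊗ ρ) ⊗ Λ (suc m)
Λ-suc m = interchange γ (γ ^ suc m) ρ (ρ ^ m)

Λ[3+j]≥3+j+γ⁻¹ : ∀ j → 0≤ (Λ (3 + j) ⊕ negate (fromℕ 3 ⊕ fromℕ j ⊕ γ⁻¹))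
Λ[3+j]≥3+j+γ⁻¹ zero    = from-yes (0≤? (Λ 3 ⊕ negate (fromℕ 3 ⊕ fromℕ 0 ⊕ γ⁻¹)))
Λ[3+j]≥3+j+γ⁻¹ (suc j) = subst 0≤_ split
  (0≤-⊕ _ _ (0≤-⊗ (γ ⊗ ρ) _ (from-yes (0≤? (γ ⊗ ρ))) (Λ[3+j]≥3+j+γ⁻¹ j))
            (0≤-⊕ _ _ (0≤-⊗ (γ ⊗ ρ ⊕ negate one) _ (from-yes (0≤? (γ ⊗ ρ ⊕ negate one))) (0≤-fromℕ j))
                      (from-yes (0≤? c))))
  where
  c : ℚ√5
  c = fromℕ 3 ⊗ (γ ⊗ ρ) ⊕ (γ ⊗ ρ) ⊗ γ⁻¹ ⊕ negate (fromℕ 3 ⊕ one ⊕ γ⁻¹)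
  -- γρ and γ⁻¹ are abstracted: with ρ as a constant the solver is very slow.
  identity : ∀ L J g i →
    g ⊗ (L ⊕ negate (fromℕ 3 ⊕ J ⊕ i))
      ⊕ ((g ⊕ negate one) ⊗ J ⊕ (fromℕ 3 ⊗ g ⊕ g ⊗ i ⊕ negate (fromℕ 3 ⊕ one ⊕ i)))
    ≡ g ⊗ L ⊕ negate (fromℕ 3 ⊕ (one ⊕ J) ⊕ i)
  identity L J g i = solve (L ∷ J ∷ g ∷ i ∷ []) ℚ√5-ring
  split : (γ ⊗ ρ) ⊗ (Λ (3 + j) ⊕ negate (fromℕ 3 ⊕ fromℕ j ⊕ γ⁻¹))
            ⊕ ((γ ⊗ ρ ⊕ negate one) ⊗ fromℕ j ⊕ c)
          ≡ Λ (3 + suc j) ⊕ negate (fromℕ 3 ⊕ fromℕ (suc j) ⊕ γ⁻¹)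
  split = trans (identity (Λ (3 + j)) (fromℕ j) (γ ⊗ ρ) γ⁻¹)
                (cong₂ (λ L J → L ⊕ negate (fromℕ 3 ⊕ J ⊕ γ⁻¹))
                       (sym (Λ-suc (2 + j))) (sym (fromℕ-homo-+ 1 j)))

module _ (L J : ℚ√5) (0≤J : 0≤ J) (0≤Δ : 0≤ (L ⊕ negate (fromℕ 3 ⊕ J ⊕ γ⁻¹))) where

  private
    0≤L : 0≤ L
    0≤L = subst 0≤_ (sym split)
      (0≤-⊕ _ _ 0≤Δ (0≤-⊕ _ _ (0≤-⊕ _ _ (0≤-fromℕ 3) 0≤J) (from-yes (0≤? γ⁻¹))))
      where
      split : L ≡ (L ⊕ negate (fromℕ 3 ⊕ J ⊕ γ⁻¹)) ⊕ (fromℕ 3 ⊕ J ⊕ γ⁻¹)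
      split = solve (L ∷ J ∷ []) ℚ√5-ring

  dominates₁-large : Dominates L one γ⁻¹ (fromℕ 3 ⊕ J ⊕ γ⁻¹) one
  dominates₁-large = dominates 0≤L
    (subst 0≤_ (sym first) 0≤Δ)
    (subst 0≤_ (sym second)
      (0≤-⊕ _ _ (0≤-⊗ _ _ 0≤Δ (from-yes (0≤? (one ⊕ γ⁻¹))))
                (0≤-⊕ _ _ (0≤-⊗ J γ⁻¹ 0≤J (from-yes (0≤? γ⁻¹)))
                          (from-yes (0≤? (fromℕ 3 ⊗ γ⁻¹ ⊕ γ⁻¹ ⊗ γ⁻¹ ⊕ negate one))))))
    where
    first : L ⊗ one ⊕ negate (fromℕ 3 ⊕ J ⊕ γ⁻¹) ≡ L ⊕ negate (fromℕ 3 ⊕ J ⊕ γ⁻¹)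
    first = solve (L ∷ J ∷ []) ℚ√5-ring
    second : (L ⊗ one ⊕ negate (fromℕ 3 ⊕ J ⊕ γ⁻¹)) ⊕ (L ⊗ γ⁻¹ ⊕ negate one)
           ≡ (L ⊕ negate (fromℕ 3 ⊕ J ⊕ γ⁻¹)) ⊗ (one ⊕ γ⁻¹)
             ⊕ (J ⊗ γ⁻¹ ⊕ (fromℕ 3 ⊗ γ⁻¹ ⊕ γ⁻¹ ⊗ γ⁻¹ ⊕ negate one))
    second = solve (L ∷ J ∷ []) ℚ√5-ring

  dominates₂-large : Dominates L (γ ^ 2) one (γ ^ 2 ⊗ (fromℕ 3 ⊕ J) ⊕ one) (γ ^ 2)
  dominates₂-large = dominates 0≤L
    (subst 0≤_ (sym first)
      (0≤-⊕ _ _ (0≤-⊗ _ _ 0≤Δ (from-yes (0≤? (γ ^ 2)))) (from-yes (0≤? (γ⁻¹ ⊗ γ ^ 2 ⊕ negate one)))))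
    (subst 0≤_ (sym second)
      (0≤-⊕ _ _ (0≤-⊗ _ _ 0≤Δ (from-yes (0≤? (γ ^ 2 ⊕ one))))
                (0≤-⊕ _ _ 0≤J
                  (from-yes (0≤? (γ⁻¹ ⊗ γ ^ 2 ⊕ negate one ⊕ fromℕ 3 ⊕ γ⁻¹ ⊕ negate (γ ^ 2)))))))
    where
    first : L ⊗ γ ^ 2 ⊕ negate (γ ^ 2 ⊗ (fromℕ 3 ⊕ J) ⊕ one)
          ≡ (L ⊕ negate (fromℕ 3 ⊕ J ⊕ γ⁻¹)) ⊗ γ ^ 2 ⊕ (γ⁻¹ ⊗ γ ^ 2 ⊕ negate one)
    first = solve (L ∷ J ∷ []) ℚ√5-ring
    second : (L ⊗ γ ^ 2 ⊕ negate (γ ^ 2 ⊗ (fromℕ 3 ⊕ J) ⊕ one)) ⊕ (L ⊗ one ⊕ negate (γ ^ 2))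
           ≡ (L ⊕ negate (fromℕ 3 ⊕ J ⊕ γ⁻¹)) ⊗ (γ ^ 2 ⊕ one)
             ⊕ (J ⊕ (γ⁻¹ ⊗ γ ^ 2 ⊕ negate one ⊕ fromℕ 3 ⊕ γ⁻¹ ⊕ negate (γ ^ 2)))
    second = solve (L ∷ J ∷ []) ℚ√5-ring

-- The invariant for the unreduced pair (N, D) of a continued fraction and its bound T.
Bounds : (D N T : ℚ√5) → Set
Bounds D N T = (one ⊗ D ⊕ γ⁻¹ ⊗ N ≼ T) × (γ ^ 2 ⊗ D ⊕ one ⊗ N ≼ Λ 2 ⊗ T)

Bounds-rescaled : ∀ m {D N T} → 1 ≤ m → 0≤ N → N ≼ D → Bounds D N T →
                  ((fromℕ m ⊕ γ⁻¹) ⊗ D ⊕ one ⊗ N ≼ Λ m ⊗ T)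
                × ((γ ^ 2 ⊗ fromℕ m ⊕ one) ⊗ D ⊕ γ ^ 2 ⊗ N ≼ Λ 2 ⊗ (Λ m ⊗ T))
Bounds-rescaled 1 {T = T} _ 0≤N N≼D (bound₁ , _) =
    ≼-rescale (from-yes (dominates? (Λ 1) one γ⁻¹ (fromℕ 1 ⊕ γ⁻¹) one)) 0≤N N≼D bound₁
  , ≼-respʳ-≡ (⊗-assoc (Λ 2) (Λ 1) T)
      (≼-rescale (from-yes (dominates? (Λ 2 ⊗ Λ 1) one γ⁻¹ (γ ^ 2 ⊗ fromℕ 1 ⊕ one) (γ ^ 2)))
                 0≤N N≼D bound₁)
Bounds-rescaled 2 {T = T} _ 0≤N N≼D (_ , bound₂) =
    ≼-respʳ-≡ (⊗-identityˡ (Λ 2 ⊗ T))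
      (≼-rescale (from-yes (dominates? one (γ ^ 2) one (fromℕ 2 ⊕ γ⁻¹) one)) 0≤N N≼D bound₂)
  , ≼-rescale (from-yes (dominates? (Λ 2) (γ ^ 2) one (γ ^ 2 ⊗ fromℕ 2 ⊕ one) (γ ^ 2))) 0≤N N≼D bound₂
Bounds-rescaled (suc (suc (suc j))) {D} {N} {T} _ 0≤N N≼D (bound₁ , bound₂) =
    subst (λ M → (M ⊕ γ⁻¹) ⊗ D ⊕ one ⊗ N ≼ L ⊗ T) (sym (fromℕ-homo-+ 3 j))
      (≼-rescale (dominates₁-large L (fromℕ j) (0≤-fromℕ j) (Λ[3+j]≥3+j+γ⁻¹ j)) 0≤N N≼D bound₁)
  , subst (λ M → (γ ^ 2 ⊗ M ⊕ one) ⊗ D ⊕ γ ^ 2 ⊗ N ≼ Λ 2 ⊗ (L ⊗ T)) (sym (fromℕ-homo-+ 3 j))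
      (≼-respʳ-≡ (x∙yz≈y∙xz L (Λ 2) T)
        (≼-rescale (dominates₂-large L (fromℕ j) (0≤-fromℕ j) (Λ[3+j]≥3+j+γ⁻¹ j)) 0≤N N≼D bound₂))
  where
  L : ℚ√5
  L = Λ (3 + j)

Bounds-cons : ∀ m {D N T} → 1 ≤ m → 0≤ N → N ≼ D → Bounds D N T →
              Bounds (fromℕ m ⊗ D ⊕ N) D (Λ m ⊗ T)
Bounds-cons m {D} {N} {T} 1≤m 0≤N N≼D bounds with Bounds-rescaled m 1≤m 0≤N N≼D bounds
... | bound₁ , bound₂ = subst (_≼ Λ m ⊗ T) (sym (regroup₁ (fromℕ m) D N γ⁻¹)) bound₁
                      , subst (_≼ Λ 2 ⊗ (Λ m ⊗ T)) (sym (regroup₂ (fromℕ m) D N (γ ^ 2))) bound₂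
  where
  regroup₁ : ∀ M D N i → one ⊗ (M ⊗ D ⊕ N) ⊕ i ⊗ D ≡ (M ⊕ i) ⊗ D ⊕ one ⊗ N
  regroup₁ M D N i = solve (M ∷ D ∷ N ∷ i ∷ []) ℚ√5-ring
  regroup₂ : ∀ M D N g → g ⊗ (M ⊗ D ⊕ N) ⊕ one ⊗ D ≡ (g ⊗ M ⊕ one) ⊗ D ⊕ g ⊗ N
  regroup₂ M D N g = solve (M ∷ D ∷ N ∷ g ∷ []) ℚ√5-ring

open import Data.List.Relation.Unary.All using (All; []; _∷_)
open import Data.List.Relation.Unary.All.Properties using (applyUpTo⁺₂)
open import Data.List.Properties using (length-applyUpTo)

cfBound : List ℕ → ℚ√5
cfBound []       = ρ⁻¹
cfBound (b ∷ bs) = Λ b ⊗ cfBound bs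

cfPair-ordered : ∀ bs → All (1 ≤_) bs → proj₁ (cfPair bs) ≤ proj₂ (cfPair bs) × 1 ≤ proj₂ (cfPair bs)
cfPair-ordered []       []               = z≤n , s≤s z≤n
cfPair-ordered (b ∷ bs) (s≤s z≤n ∷ 1≤bs) = d≤bd+n , ℕ.≤-trans (proj₂ (cfPair-ordered bs 1≤bs)) d≤bd+n
  where
  d≤bd+n : proj₂ (cfPair bs) ≤ b * proj₂ (cfPair bs) + proj₁ (cfPair bs)
  d≤bd+n = ℕ.≤-trans (ℕ.m≤n*m _ b) (ℕ.m≤m+n _ _)

cfPair-Bounds : ∀ bs → All (1 ≤_) bs →
                Bounds (fromℕ (proj₂ (cfPair bs))) (fromℕ (proj₁ (cfPair bs))) (cfBound bs)
cfPair-Bounds []       []           = from-yes (one ⊗ fromℕ 1 ⊕ γ⁻¹ ⊗ fromℕ 0 ≼? ρ⁻¹)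
                                    , from-yes (γ ^ 2 ⊗ fromℕ 1 ⊕ one ⊗ fromℕ 0 ≼? Λ 2 ⊗ ρ⁻¹)
cfPair-Bounds (b ∷ bs) (1≤b ∷ 1≤bs) = subst (λ D → Bounds D (fromℕ d) (Λ b ⊗ cfBound bs)) (sym fromℕ-bd+n)
  (Bounds-cons b 1≤b (0≤-fromℕ n) (fromℕ-mono-≼ (proj₁ (cfPair-ordered bs 1≤bs))) (cfPair-Bounds bs 1≤bs))
  where
  n : ℕ
  n = proj₁ (cfPair bs)
  d : ℕ
  d = proj₂ (cfPair bs)
  fromℕ-bd+n : fromℕ (b * d + n) ≡ fromℕ b ⊗ fromℕ d ⊕ fromℕ n
  fromℕ-bd+n = trans (fromℕ-homo-+ (b * d) n) (cong (_⊕ fromℕ n) (fromℕ-homo-* b d))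

length≤sum : ∀ {bs} → All (1 ≤_) bs → length bs ≤ sum bs
length≤sum []           = z≤n
length≤sum (1≤b ∷ 1≤bs) = ℕ.+-mono-≤ 1≤b (length≤sum 1≤bs)

cfBound-closed : ∀ bs → All (1 ≤_) bs → cfBound bs ≡ (γ ^ sum bs ⊗ ρ ^ (sum bs ∸ length bs)) ⊗ ρ⁻¹
cfBound-closed []           []               = sym (⊗-identityˡ ρ⁻¹)
cfBound-closed (suc c ∷ bs) (s≤s z≤n ∷ 1≤bs) = begin
  Λ (suc c) ⊗ cfBound bs
    ≡⟨ cong (Λ (suc c) ⊗_) (cfBound-closed bs 1≤bs) ⟩
  (γ ^ suc c ⊗ ρ ^ c) ⊗ ((γ ^ s ⊗ ρ ^ e) ⊗ ρ⁻¹)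
    ≡⟨ ⊗-assoc (γ ^ suc c ⊗ ρ ^ c) (γ ^ s ⊗ ρ ^ e) ρ⁻¹ ⟨
  ((γ ^ suc c ⊗ ρ ^ c) ⊗ (γ ^ s ⊗ ρ ^ e)) ⊗ ρ⁻¹
    ≡⟨ cong (_⊗ ρ⁻¹) (interchange (γ ^ suc c) (ρ ^ c) (γ ^ s) (ρ ^ e)) ⟩
  ((γ ^ suc c ⊗ γ ^ s) ⊗ (ρ ^ c ⊗ ρ ^ e)) ⊗ ρ⁻¹
    ≡⟨ cong₂ (λ G P → (G ⊗ P) ⊗ ρ⁻¹) (^-homo-+ γ (suc c) s) (^-homo-+ ρ c e) ⟨
  (γ ^ (suc c + s) ⊗ ρ ^ (c + e)) ⊗ ρ⁻¹
    ≡⟨ cong (λ k → (γ ^ (suc c + s) ⊗ ρ ^ k) ⊗ ρ⁻¹) (ℕ.+-∸-assoc c (length≤sum 1≤bs)) ⟨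
  (γ ^ (suc c + s) ⊗ ρ ^ ((c + s) ∸ length bs)) ⊗ ρ⁻¹ ∎
  where
  open ≡-Reasoning
  s : ℕ
  s = sum bs
  e : ℕ
  e = s ∸ length bs

γ^s⊗ρ^[s-k-1]≡ : ∀ {s k} → k ≤ s →
                 γ ^ s ⊗ powℤ ρ ρ⁻¹ (+ s ℤ.- + k ℤ.- + 1) ≡ (γ ^ s ⊗ ρ ^ (s ∸ k)) ⊗ ρ⁻¹
γ^s⊗ρ^[s-k-1]≡ {s} {k} k≤s = begin
  γ ^ s ⊗ powℤ ρ ρ⁻¹ (+ s ℤ.- + k ℤ.- + 1)
    ≡⟨ cong (λ z → γ ^ s ⊗ powℤ ρ ρ⁻¹ (z ℤ.- + 1)) s-k≡s∸k ⟩
  γ ^ s ⊗ powℤ ρ ρ⁻¹ (+ (s ∸ k) ℤ.- + 1)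
    ≡⟨ cong (γ ^ s ⊗_) (powℤ-pred ρ ρ⁻¹ ρ-inv (s ∸ k)) ⟩
  γ ^ s ⊗ (ρ ^ (s ∸ k) ⊗ ρ⁻¹)
    ≡⟨ ⊗-assoc (γ ^ s) (ρ ^ (s ∸ k)) ρ⁻¹ ⟨
  (γ ^ s ⊗ ρ ^ (s ∸ k)) ⊗ ρ⁻¹ ∎
  where
  open ≡-Reasoning
  s-k≡s∸k : + s ℤ.- + k ≡ + (s ∸ k)
  s-k≡s∸k = trans (ℤ.[+m]-[+n]≡m⊖n s k) (ℤ.⊖-≥ k≤s)

↧ₙ[n/d]≤d : ∀ n d → ↧ₙ (+ n / suc d) ≤ suc d
↧ₙ[n/d]≤d n d = ∣⇒≤ (subst (↧ₙ (+ n / suc d) ∣_) ↧ₙ*gcd≡d (m∣m*n (gcd n (suc d))))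
  where
  ↧ₙ*gcd≡d : ↧ₙ (+ n / suc d) * gcd n (suc d) ≡ suc d
  ↧ₙ*gcd≡d = ℤ.+-injective (trans (ℤ.pos-* (↧ₙ (+ n / suc d)) (gcd n (suc d))) (ℚ.↧-/ (+ n) (suc d)))

↧ₙ[cfValue]≤denominator : ∀ bs → 1 ≤ proj₂ (cfPair bs) → ↧ₙ (cfValue bs) ≤ proj₂ (cfPair bs)
↧ₙ[cfValue]≤denominator bs 1≤d with cfPair bs
... | n , suc d = ↧ₙ[n/d]≤d n d

lemma4p6 : (a : ℕ → ℕ) → (∀ i → 1 ≤ a (suc i)) → (k : ℕ) →
    fromℕ (q a k) ≤√ (γ ^ τ a k) ⊗ powℤ ρ ρ⁻¹ (expo a k)
lemma4p6 a 1≤a k = ≼⇒≤√ (begin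
  fromℕ (q a k)                  ≲⟨ fromℕ-mono-≼ (↧ₙ[cfValue]≤denominator bs 1≤d) ⟩
  fromℕ d                        ≲⟨ ≼⊕ (fromℕ d) 0≤γ⁻¹n ⟩
  fromℕ d ⊕ γ⁻¹ ⊗ fromℕ n        ≡⟨ cong (_⊕ γ⁻¹ ⊗ fromℕ n) (⊗-identityˡ (fromℕ d)) ⟨
  one ⊗ fromℕ d ⊕ γ⁻¹ ⊗ fromℕ n  ≲⟨ proj₁ (cfPair-Bounds bs 1≤bs) ⟩
  cfBound bs                     ≡⟨ cfBound-closed bs 1≤bs ⟩
  (γ ^ τ a k ⊗ ρ ^ (τ a k ∸ length bs)) ⊗ ρ⁻¹
    ≡⟨ cong (λ l → (γ ^ τ a k ⊗ ρ ^ (τ a k ∸ l)) ⊗ ρ⁻¹) length≡k ⟩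
  (γ ^ τ a k ⊗ ρ ^ (τ a k ∸ k)) ⊗ ρ⁻¹
    ≡⟨ γ^s⊗ρ^[s-k-1]≡ k≤τ ⟨
  γ ^ τ a k ⊗ powℤ ρ ρ⁻¹ (expo a k) ∎)
  where
  open ≼-Reasoning
  bs : List ℕ
  bs = prefix a k
  1≤bs : All (1 ≤_) bs
  1≤bs = applyUpTo⁺₂ (λ i → a (suc i)) k 1≤a
  n : ℕ
  n = proj₁ (cfPair bs)
  d : ℕ
  d = proj₂ (cfPair bs)
  1≤d : 1 ≤ d
  1≤d = proj₂ (cfPair-ordered bs 1≤bs)
  0≤γ⁻¹n : 0≤ (γ⁻¹ ⊗ fromℕ n)
  0≤γ⁻¹n = 0≤-⊗ γ⁻¹ (fromℕ n) (from-yes (0≤? γ⁻¹)) (0≤-fromℕ n)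
  length≡k : length bs ≡ k
  length≡k = length-applyUpTo (λ i → a (suc i)) k
  k≤τ : k ≤ τ a k
  k≤τ = subst (_≤ τ a k) length≡k (length≤sum 1≤bs)
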